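{- Let $n\ge2$, $r\ge1$, $p$ a positive divisor of $r$, and $\alpha$ an integer with $0\le\alpha<r/p$. Let $H$ be the subgroup of $G(r,p,n)$ generated by $u_0,\dots,u_{n-2}$, where $u_i=(\bar c_i;t_i)$, $t_0=\mathrm{id}$, $t_i=s_is_{i-1}\cdots s_1$ ($s_j=(j,j+1)$) for $1\le i\le n-2$, and $\bar c_i=(1,0,\dots,0,\alpha p-1)\in\mathbf Z_r^n$. Then $H$ is isomorphic to $G(r,n-1)$.
   Context: $G(r,n)$ is the set of pairs $((c_1,\dots,c_n);\pi)$, $c_i\in\mathbf Z_r=\mathbf Z/r\mathbf Z$, $\pi\in S_n$, with multiplication $((c_1,\dots,c_n);\pi)\cdot((c'_1,\dots,c'_n);\pi')=((c_1+c'_{\pi^{ -1}(1)},\dots,c_n+c'_{\pi^{ -1}(n)});\pi\pi')$, $(\pi\pi')(j)=\pi(\pi'(j))$. For $p\mid r$, $G(r,p,n)$ is the subgroup of elements with $\sum_ic_i\equiv0\pmod p$. The permutation $t_i$ satisfies $t_i(1)=i+1$, $t_i(j)=j-1$ for $2\le j\le i+1$, $t_i(j)=j$ otherwise. In $\bar c_i$ the first coordinate is $1$, the last is $\alpha p-1$, all others $0$. -}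

module Defs where

open import Data.Nat using (ℕ; zero; suc; _+_; _*_; _∸_; _<_; _≡ᵇ_; NonZero)
open import Data.Nat.Properties using (<-trans; n<1+n)
open import Data.Nat.DivMod using (_mod_)
open import Data.Fin using (Fin; toℕ; fromℕ<)
open import Data.Fin.Properties using (toℕ<n)
open import Data.Fin.Permutation using (Permutation′; _⟨$⟩ʳ_; _⟨$⟩ˡ_; _∘ₚ_; transpose; id; flip)
open import Data.Bool using (if_then_else_)
open import Data.Product using (Σ; _×_; _,_; proj₁)
open import Relation.Binary.PropositionalEquality using (_≡_)

module _ (r : ℕ) .{{_ : NonZero r}} where

  _+r_ : Fin r → Fin r → Fin r
  a +r b = (toℕ a + toℕ b) mod r

  -r_ : Fin r → Fin r
  -r a = (r ∸ toℕ a) mod r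

  0r : Fin r
  0r = 0 mod r

-- G(r,n): pairs ((c_1,…,c_n);π), c_i ∈ Z_r, π ∈ S_n  (positions 0-indexed)

record GEl (r n : ℕ) : Set where
  constructor ⟪_,_⟫
  field
    coef : Fin n → Fin r
    perm : Permutation′ n
open GEl public

_≈G_ : ∀ {r n} → GEl r n → GEl r n → Set
x ≈G y = (∀ j → coef x j ≡ coef y j) × (∀ j → perm x ⟨$⟩ʳ j ≡ perm y ⟨$⟩ʳ j)

module _ {r : ℕ} .{{_ : NonZero r}} {n : ℕ} where

  -- ((c);π)·((c');π') = ((c_j + c'_{π⁻¹(j)})_j ; ππ'),  (ππ')(j) = π(π'(j))
  -- (stdlib: π' ∘ₚ π applies π' first, then π)
  _·G_ : GEl r n → GEl r n → GEl r n
  ⟪ c , π ⟫ ·G ⟪ c' , π' ⟫ = ⟪ (λ j → _+r_ r (c j) (c' (π ⟨$⟩ˡ j))) , π' ∘ₚ π ⟫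

  εG : GEl r n
  εG = ⟪ (λ _ → 0r r) , id ⟫

  invG : GEl r n → GEl r n
  invG ⟪ c , π ⟫ = ⟪ (λ j → -r_ r (c (π ⟨$⟩ʳ j))) , flip π ⟫

  data InGen {I : Set} (g : I → GEl r n) : GEl r n → Set where
    gen  : ∀ i → InGen g (g i)
    one  : InGen g εG
    mul  : ∀ {x y} → InGen g x → InGen g y → InGen g (x ·G y)
    inv  : ∀ {x} → InGen g x → InGen g (invG x)
    resp : ∀ {x y} → x ≈G y → InGen g x → InGen g y

IsoGenG : ∀ {r n I} .{{_ : NonZero r}} → (I → GEl r n) → ℕ → Set
IsoGenG {r} {n} g k =
  Σ (Σ (GEl r n) (InGen g) → GEl r k) λ f →
    (∀ x y → proj₁ x ≈G proj₁ y → f x ≈G f y) ×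
    (∀ x y → f (proj₁ x ·G proj₁ y , mul (Data.Product.proj₂ x) (Data.Product.proj₂ y)) ≈G (f x ·G f y)) ×
    (∀ x y → f x ≈G f y → proj₁ x ≈G proj₁ y) ×
    (∀ z → Σ (Σ (GEl r n) (InGen g)) λ x → f x ≈G z)

-- The generators u_0,…,u_{n-2} of H, for n = m + 2 (positions 0..m+1)

module _ (m : ℕ) where

  -- s_{j+1} = transposition of (0-indexed) positions j and j+1
  s : Fin (suc m) → Permutation′ (suc (suc m))
  s j = transpose (Data.Fin.inject₁ j) (Data.Fin.suc j)

  -- t_0 = id,  t_{i+1} = s_{i+1} t_i  (t_i applied first)
  t : (i : ℕ) → i < suc m → Permutation′ (suc (suc m))
  t zero    _ = id
  t (suc i) h = t i h' ∘ₚ s (fromℕ< h')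
    where h' = <-trans (n<1+n i) h

module _ (m r p α : ℕ) .{{_ : NonZero r}} where

  -- c̄ = (1, 0, …, 0, αp − 1) ∈ Z_r^{m+2}
  cbar : Fin (suc (suc m)) → Fin r
  cbar j = if toℕ j ≡ᵇ 0 then 1 mod r
           else if toℕ j ≡ᵇ suc m then (α * p + (r ∸ 1)) mod r
           else 0 mod r

  u : Fin (suc m) → GEl r (suc (suc m))
  u i = ⟪ cbar , t m (toℕ i) (toℕ<n i) ⟫

module Submission where

-- Write w = αp − 1.  Each u_i fixes the last position, and its last coefficient is w times the
-- sum of the other ones.  For any additive φ : ℤ/r → ℤ/r, the elements of G(r,n) that fix the last
-- position and whose last coefficient is φ of the sum of the others form a subgroup (the section of
-- φ), on which the map `restrict` forgetting the last position is an injective homomorphism into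
-- G(r,n−1); hence restrict embeds H.  It is onto: H contains u₀⁻¹u_i = t_i, hence t_{i+1}t_i⁻¹ =
-- s_{i+1}, hence every permutation of the first n−1 positions (adjacent transpositions generate
-- S_{n−1}), and restrict u₀ is a diagonal unit vector.  Finally G(r,n−1) is generated by its
-- permutations and one diagonal unit vector: conjugation moves the unit vector to any position,
-- and products of those give every diagonal element.

open import Defs
open import Data.Nat using (ℕ; suc; _<_; _/_; NonZero)
open import Data.Nat.Divisibility using (_∣_)
open import Level using (0ℓ)
open import Data.Nat using (zero; _+_; _*_; _∸_; _%_; >-nonZero⁻¹)
open import Data.Nat.Properties using (+-assoc; +-comm; m∸n+n≡m; <⇒≤; <-trans; n<1+n; <⇒≢; ≤-trans; ≤-reflexive)
import Data.Nat.Properties as ℕ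
open import Data.Nat.DivMod using (_mod_; %-distribˡ-+; m<n⇒m%n≡m; n%n≡0; m%n<n)
open import Data.Fin using (Fin; zero; suc; toℕ; fromℕ; fromℕ<; inject₁; punchIn; punchOut)
open import Data.Fin.Properties
  using (_≟_; toℕ-fromℕ; toℕ-fromℕ<; fromℕ<-cong; fromℕ<-toℕ; toℕ<n; toℕ-inject₁; toℕ-injective;
         suc-injective; fromℕ≢inject₁; punchIn-punchOut; punchIn-injective; punchInᵢ≢i)
open import Data.Fin.Permutation
  using (Permutation′; _⟨$⟩ʳ_; _⟨$⟩ˡ_; _∘ₚ_; id; flip; transpose; lift₀; remove; insert;
         inverseˡ; inverseʳ; lift₀-id; lift₀-comp; lift₀-cong; lift₀-transpose; lift₀-remove;
         insert-punchIn; punchIn-permute; remove-insert)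
  renaming (_≈_ to _≈ₚ_)
import Data.Fin.Permutation.Components as PC
open import Algebra.Bundles using (Monoid; AbelianGroup)
open import Data.Empty using (⊥-elim)
open import Data.Product using (Σ; _×_; _,_; proj₁; proj₂)
open import Function using (_∘_)
open import Relation.Nullary using (Dec; yes; no)
open import Relation.Nullary.Decidable using (dec-true; dec-false)
open import Relation.Nullary.Negation using (contradiction)
open import Relation.Binary.PropositionalEquality
  using (_≡_; _≢_; refl; sym; trans; cong; cong₂; subst; isEquivalence; module ≡-Reasoning)

-- Arithmetic of ℤ/r = Fin r, transferred from ℕ along the residue map ⟦_⟧.
module IntegersModulo (r : ℕ) .{{_ : NonZero r}} where

  infixl 6 _+ᵣ_
  _+ᵣ_ : Fin r → Fin r → Fin r
  _+ᵣ_ = _+r_ r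

  ⟦_⟧ : ℕ → Fin r
  ⟦ a ⟧ = a mod r

  ⟦⟧-homo-+ : ∀ a b → ⟦ a + b ⟧ ≡ ⟦ a ⟧ +ᵣ ⟦ b ⟧
  ⟦⟧-homo-+ a b = fromℕ<-cong _ _ (begin
      (a + b) % r              ≡⟨ %-distribˡ-+ a b r ⟩
      (a % r + b % r) % r      ≡⟨ cong₂ (λ x y → (x + y) % r) (toℕ-fromℕ< (m%n<n a r)) (toℕ-fromℕ< (m%n<n b r)) ⟨
      (toℕ ⟦ a ⟧ + toℕ ⟦ b ⟧) % r ∎) _ _
    where open ≡-Reasoning

  ⟦toℕ⟧ : ∀ (a : Fin r) → ⟦ toℕ a ⟧ ≡ a
  ⟦toℕ⟧ a = trans (fromℕ<-cong _ _ (m<n⇒m%n≡m (toℕ<n a)) _ (toℕ<n a)) (fromℕ<-toℕ a (toℕ<n a))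

  private
    ⟦⟧+ʳ : ∀ a (b : Fin r) → ⟦ a ⟧ +ᵣ b ≡ ⟦ a + toℕ b ⟧
    ⟦⟧+ʳ a b = trans (cong (⟦ a ⟧ +ᵣ_) (sym (⟦toℕ⟧ b))) (sym (⟦⟧-homo-+ a (toℕ b)))

    ⟦⟧+ˡ : ∀ (a : Fin r) b → a +ᵣ ⟦ b ⟧ ≡ ⟦ toℕ a + b ⟧
    ⟦⟧+ˡ a b = trans (cong (_+ᵣ ⟦ b ⟧) (sym (⟦toℕ⟧ a))) (sym (⟦⟧-homo-+ (toℕ a) b))

  +r-assoc : ∀ a b c → (a +ᵣ b) +ᵣ c ≡ a +ᵣ (b +ᵣ c)
  +r-assoc a b c = trans (⟦⟧+ʳ (toℕ a + toℕ b) c)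
    (trans (cong ⟦_⟧ (+-assoc (toℕ a) (toℕ b) (toℕ c))) (sym (⟦⟧+ˡ a (toℕ b + toℕ c))))

  +r-comm : ∀ a b → a +ᵣ b ≡ b +ᵣ a
  +r-comm a b = cong ⟦_⟧ (+-comm (toℕ a) (toℕ b))

  +r-identityˡ : ∀ a → 0r r +ᵣ a ≡ a
  +r-identityˡ a = trans (⟦⟧+ʳ 0 a) (⟦toℕ⟧ a)

  +r-identityʳ : ∀ a → a +ᵣ 0r r ≡ a
  +r-identityʳ a = trans (+r-comm a (0r r)) (+r-identityˡ a)

  -r-inverseˡ : ∀ a → (-r_ r a) +ᵣ a ≡ 0r r
  -r-inverseˡ a = begin
    ⟦ r ∸ toℕ a ⟧ +ᵣ a      ≡⟨ ⟦⟧+ʳ (r ∸ toℕ a) a ⟩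
    ⟦ r ∸ toℕ a + toℕ a ⟧   ≡⟨ cong ⟦_⟧ (m∸n+n≡m (<⇒≤ (toℕ<n a))) ⟩
    ⟦ r ⟧                   ≡⟨ fromℕ<-cong _ _ (trans (n%n≡0 r) (sym (m<n⇒m%n≡m (>-nonZero⁻¹ r)))) _ _ ⟩
    ⟦ 0 ⟧                   ∎
    where open ≡-Reasoning

  -r-inverseʳ : ∀ a → a +ᵣ (-r_ r a) ≡ 0r r
  -r-inverseʳ a = trans (+r-comm a (-r_ r a)) (-r-inverseˡ a)

  ℤ/r : AbelianGroup 0ℓ 0ℓ
  ℤ/r = record
    { Carrier = Fin r ; _≈_ = _≡_ ; _∙_ = _+ᵣ_ ; ε = 0r r ; _⁻¹ = -r_ r
    ; isAbelianGroup = record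
      { isGroup = record
        { isMonoid = record
          { isSemigroup = record
            { isMagma = record { isEquivalence = isEquivalence ; ∙-cong = cong₂ _+ᵣ_ }
            ; assoc = +r-assoc }
          ; identity = +r-identityˡ , +r-identityʳ }
        ; inverse = -r-inverseˡ , -r-inverseʳ
        ; ⁻¹-cong = cong (-r_ r) }
      ; comm = +r-comm } }

  open import Algebra.Properties.Monoid.Mult (AbelianGroup.monoid ℤ/r) using () renaming (_×_ to _×ᵣ_)

  ⟦⟧-multiple : ∀ m → ⟦ m ⟧ ≡ m ×ᵣ ⟦ 1 ⟧
  ⟦⟧-multiple zero    = refl
  ⟦⟧-multiple (suc m) = trans (⟦⟧-homo-+ 1 m) (cong (⟦ 1 ⟧ +ᵣ_) (⟦⟧-multiple m))

module UnitVectors {c ℓ} (M : Monoid c ℓ) where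

  open Monoid M renaming (ε to 0#; refl to ≈-refl; sym to ≈-sym; trans to ≈-trans)
  open import Algebra.Properties.Monoid.Sum M using (sum; sum-replicate-zero)

  unit : ∀ {n} → Fin n → Carrier → Fin n → Carrier
  unit zero    a zero    = a
  unit zero    a (suc j) = 0#
  unit (suc k) a zero    = 0#
  unit (suc k) a (suc j) = unit k a j

  unit-at : ∀ {n} (k : Fin n) a → unit k a k ≡ a
  unit-at zero    a = refl
  unit-at (suc k) a = unit-at k a

  unit-off : ∀ {n} (k j : Fin n) a → j ≢ k → unit k a j ≡ 0#
  unit-off zero    zero    a j≢k = ⊥-elim (j≢k refl)
  unit-off zero    (suc j) a _   = refl
  unit-off (suc k) zero    a _   = refl
  unit-off (suc k) (suc j) a j≢k = unit-off k j a (λ j≡k → j≢k (cong suc j≡k))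

  unit-homo : ∀ {n} (k j : Fin n) a b → unit k (a ∙ b) j ≈ unit k a j ∙ unit k b j
  unit-homo zero    zero    a b = ≈-refl
  unit-homo zero    (suc j) a b = ≈-sym (identityˡ 0#)
  unit-homo (suc k) zero    a b = ≈-sym (identityˡ 0#)
  unit-homo (suc k) (suc j) a b = unit-homo k j a b

  unit-sum : ∀ {n} (k : Fin n) a → sum (unit k a) ≈ a
  unit-sum {suc n} zero    a = ≈-trans (∙-congˡ (sum-replicate-zero n)) (identityʳ a)
  unit-sum {suc n} (suc k) a = ≈-trans (identityˡ _) (unit-sum k a)

  unit-permute : ∀ {n} (ρ : Permutation′ n) k a j → unit k a (ρ ⟨$⟩ˡ j) ≡ unit (ρ ⟨$⟩ʳ k) a j
  unit-permute ρ k a j with j ≟ ρ ⟨$⟩ʳ k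
  ... | yes refl = trans (cong (λ x → unit k a x) (inverseˡ ρ)) (trans (unit-at k a) (sym (unit-at (ρ ⟨$⟩ʳ k) a)))
  ... | no j≢ρk =
    trans (unit-off k _ a (λ ρ⁻¹j≡k → j≢ρk (trans (sym (inverseʳ ρ)) (cong (ρ ⟨$⟩ʳ_) ρ⁻¹j≡k))))
          (sym (unit-off _ j a j≢ρk))

  -- A property of vectors that holds for 0 and is stable under adding unit vectors holds for all
  -- vectors (induction on the length: d = unit 0 (d 0) + (0, d 1, …, d n)).
  vector-induction : ∀ {p} n (P : (Fin n → Carrier) → Set p) →
    (∀ {d d'} → (∀ j → d j ≈ d' j) → P d → P d') →
    P (λ _ → 0#) → (∀ k a d → P d → P (λ j → unit k a j ∙ d j)) → ∀ d → P d
  vector-induction zero P P-resp P0 step d = P-resp (λ ()) P0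
  vector-induction (suc n) P P-resp P0 step d =
    P-resp split (step zero (d zero) (zero-head (λ k → d (suc k))) tail-ok)
    where
    zero-head : (Fin n → Carrier) → Fin (suc n) → Carrier
    zero-head e zero    = 0#
    zero-head e (suc k) = e k
    tail-ok : P (zero-head (λ k → d (suc k)))
    tail-ok = vector-induction n (λ e → P (zero-head e))
      (λ e≈ → P-resp (λ { zero → ≈-refl ; (suc j) → e≈ j }))
      (P-resp (λ { zero → ≈-refl ; (suc j) → ≈-refl }) P0)
      (λ k a e Pe → P-resp (λ { zero → identityˡ 0# ; (suc j) → ≈-refl }) (step (suc k) a (zero-head e) Pe))
      (λ k → d (suc k))
    split : ∀ j → unit zero (d zero) j ∙ zero-head (λ k → d (suc k)) j ≈ d j
    split zero    = identityʳ (d zero)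
    split (suc j) = identityˡ (d (suc j))

  unit-zero : ∀ {n} (k j : Fin n) → unit k 0# j ≡ 0#
  unit-zero zero    zero    = refl
  unit-zero zero    (suc j) = refl
  unit-zero (suc k) zero    = refl
  unit-zero (suc k) (suc j) = unit-zero k j

record IsSubmonoid {n : ℕ} (P : Permutation′ n → Set) : Set where
  field
    respects : ∀ {π ρ} → π ≈ₚ ρ → P π → P ρ
    has-id   : P id
    closed-∘ : ∀ {π ρ} → P π → P ρ → P (π ∘ₚ ρ)

adjacent : ∀ {n} → Fin n → Permutation′ (suc n)
adjacent i = transpose (inject₁ i) (suc i)

lift₀-submonoid : ∀ {n} {P : Permutation′ (suc n) → Set} → IsSubmonoid P → IsSubmonoid (P ∘ lift₀)
lift₀-submonoid {P = P} sub = record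
  { respects = λ {π} {ρ} e → respects (lift₀-cong π ρ e)
  ; has-id   = respects (λ i → sym (lift₀-id i)) has-id
  ; closed-∘ = λ {π} {ρ} p q → respects (lift₀-comp π ρ) (closed-∘ p q)
  }
  where open IsSubmonoid sub

transpose-00 : ∀ {n} → id ≈ₚ transpose {suc n} zero zero
transpose-00 zero    = refl
transpose-00 (suc k) = refl

transpose-10 : ∀ {n} → adjacent {suc n} zero ≈ₚ transpose (suc zero) zero
transpose-10 zero          = refl
transpose-10 (suc zero)    = refl
transpose-10 (suc (suc k)) = refl

transpose-conjugate : ∀ {n} (b : Fin n) →
  (adjacent zero ∘ₚ (lift₀ (transpose (suc b) zero) ∘ₚ adjacent zero)) ≈ₚ transpose (suc (suc b)) zero
transpose-conjugate b zero          = refl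
transpose-conjugate b (suc zero)    = refl
transpose-conjugate b (suc (suc k)) with k ≟ b
... | yes _ = refl
... | no  _ = refl

factor-at-zero : ∀ {n} (π : Permutation′ (suc n)) →
  (transpose (π ⟨$⟩ˡ zero) zero ∘ₚ lift₀ (remove zero (transpose zero (π ⟨$⟩ˡ zero) ∘ₚ π))) ≈ₚ π
factor-at-zero π i = trans
  (lift₀-remove (transpose zero (π ⟨$⟩ˡ zero) ∘ₚ π) (inverseʳ π) (transpose (π ⟨$⟩ˡ zero) zero ⟨$⟩ʳ i))
  (cong (π ⟨$⟩ʳ_) (PC.transpose-inverse zero (π ⟨$⟩ˡ zero)))

-- The adjacent transpositions generate the symmetric group: by induction on n, with the
-- factorisation above, transpositions (b, 0) built by conjugation, and lift₀ of smaller ones.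
adjacent-generate : ∀ n (P : Permutation′ (suc n) → Set) → IsSubmonoid P →
  (∀ i → P (adjacent i)) → ∀ π → P π
adjacent-generate zero P sub _ π = respects (λ { zero → sym (only-point (π ⟨$⟩ʳ zero)) }) has-id
  where
  open IsSubmonoid sub
  only-point : (i : Fin 1) → i ≡ zero
  only-point zero = refl
adjacent-generate (suc n) P sub adj π =
  respects (factor-at-zero π) (closed-∘ (with-zero (π ⟨$⟩ˡ zero)) (lifted _))
  where
  open IsSubmonoid sub
  lifted : ∀ ρ → P (lift₀ ρ)
  lifted = adjacent-generate n (P ∘ lift₀) (lift₀-submonoid sub)
             (λ i → respects (lift₀-transpose (inject₁ i) (suc i)) (adj (suc i)))
  with-zero : ∀ b → P (transpose b zero)
  with-zero zero          = respects transpose-00 has-id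
  with-zero (suc zero)    = respects transpose-10 (adj zero)
  with-zero (suc (suc b)) = respects (transpose-conjugate b)
    (closed-∘ (adj zero) (closed-∘ (lifted (transpose (suc b) zero)) (adj zero)))

module _ {n : ℕ} (i j : Fin n) where

  transpose-at-i : PC.transpose i j i ≡ j
  transpose-at-i with i ≟ i
  ... | yes _  = refl
  ... | no i≢i = contradiction refl i≢i

  transpose-at-j : PC.transpose i j j ≡ i
  transpose-at-j with j ≟ i
  ... | yes j≡i = j≡i
  ... | no _ with j ≟ j
  ...   | yes _  = refl
  ...   | no j≢j = contradiction refl j≢j

  transpose-elsewhere : ∀ {k} → k ≢ i → k ≢ j → PC.transpose i j k ≡ k
  transpose-elsewhere {k} k≢i k≢j with k ≟ i
  ... | yes k≡i = contradiction k≡i k≢i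
  ... | no _ with k ≟ j
  ...   | yes k≡j = contradiction k≡j k≢j
  ...   | no _    = refl

transpose-natural : ∀ {m n} (f : Fin m → Fin n) → (∀ {x y} → f x ≡ f y → x ≡ y) →
  ∀ i j k → PC.transpose (f i) (f j) (f k) ≡ f (PC.transpose i j k)
transpose-natural f f-inj i j k = by-cases (k ≟ i) (k ≟ j)
  where
  by-cases : Dec (k ≡ i) → Dec (k ≡ j) → PC.transpose (f i) (f j) (f k) ≡ f (PC.transpose i j k)
  by-cases (yes refl) _ = trans (transpose-at-i (f k) (f j)) (cong f (sym (transpose-at-i k j)))
  by-cases (no _) (yes refl) = trans (transpose-at-j (f i) (f k)) (cong f (sym (transpose-at-j i k)))
  by-cases (no k≢i) (no k≢j) = trans (transpose-elsewhere (f i) (f j) (k≢i ∘ f-inj) (k≢j ∘ f-inj))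
                                     (cong f (sym (transpose-elsewhere i j k≢i k≢j)))

last : ∀ {n} → Fin (suc n)
last {n} = fromℕ n

ι : ∀ {n} → Fin n → Fin (suc n)
ι = punchIn last

ι-injective : ∀ {n} {x y : Fin n} → ι x ≡ ι y → x ≡ y
ι-injective = punchIn-injective last _ _

ι≡inject₁ : ∀ {n} (k : Fin n) → ι k ≡ inject₁ k
ι≡inject₁ zero    = refl
ι≡inject₁ (suc k) = cong suc (ι≡inject₁ k)

toℕ-ι : ∀ {n} (k : Fin n) → toℕ (ι k) ≡ toℕ k
toℕ-ι k = trans (cong toℕ (ι≡inject₁ k)) (toℕ-inject₁ k)

toℕ-ι<n : ∀ {n} (k : Fin n) → toℕ (ι k) < n
toℕ-ι<n k = ≤-trans (≤-reflexive (cong suc (toℕ-ι k))) (toℕ<n k)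

agree-last-ι : ∀ {n} {X : Set} (f g : Fin (suc n) → X) →
  f last ≡ g last → (∀ k → f (ι k) ≡ g (ι k)) → ∀ j → f j ≡ g j
agree-last-ι f g at-last along-ι j with last ≟ j
... | yes refl    = at-last
... | no  last≢j = subst (λ x → f x ≡ g x) (punchIn-punchOut last≢j) (along-ι (punchOut last≢j))

inverse-of : ∀ {n} (π : Permutation′ n) {x y} → π ⟨$⟩ʳ x ≡ y → π ⟨$⟩ˡ y ≡ x
inverse-of π refl = inverseˡ π

Fixes : ∀ {n} → Permutation′ (suc n) → Set
Fixes π = π ⟨$⟩ʳ last ≡ last

fixLast : ∀ {n} → Permutation′ n → Permutation′ (suc n)
fixLast = insert last last

module _ {n : ℕ} where

  fixLast-last : (σ : Permutation′ n) → Fixes (fixLast σ)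
  fixLast-last σ with last {n} ≟ last
  ... | yes _       = refl
  ... | no last≢last = contradiction refl last≢last

  fixLast-ι : ∀ (σ : Permutation′ n) k → fixLast σ ⟨$⟩ʳ ι k ≡ ι (σ ⟨$⟩ʳ k)
  fixLast-ι = insert-punchIn last last

  fixLast-unique : ∀ (σ : Permutation′ n) ρ → Fixes ρ → (∀ k → ρ ⟨$⟩ʳ ι k ≡ ι (σ ⟨$⟩ʳ k)) →
    fixLast σ ≈ₚ ρ
  fixLast-unique σ ρ ρ-fixes ρ-ι = agree-last-ι _ _
    (trans (fixLast-last σ) (sym ρ-fixes)) (λ k → trans (fixLast-ι σ k) (sym (ρ-ι k)))

  fixLast-id : fixLast id ≈ₚ id
  fixLast-id = fixLast-unique id id refl (λ _ → refl)

  fixLast-∘ : ∀ (σ τ : Permutation′ n) → fixLast (σ ∘ₚ τ) ≈ₚ (fixLast σ ∘ₚ fixLast τ)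
  fixLast-∘ σ τ = fixLast-unique (σ ∘ₚ τ) (fixLast σ ∘ₚ fixLast τ)
    (trans (cong (fixLast τ ⟨$⟩ʳ_) (fixLast-last σ)) (fixLast-last τ))
    (λ k → trans (cong (fixLast τ ⟨$⟩ʳ_) (fixLast-ι σ k)) (fixLast-ι τ _))

  fixLast-cong : ∀ {σ τ : Permutation′ n} → σ ≈ₚ τ → fixLast σ ≈ₚ fixLast τ
  fixLast-cong {σ} {τ} σ≈τ = fixLast-unique σ (fixLast τ) (fixLast-last τ)
    (λ k → trans (fixLast-ι τ k) (cong ι (sym (σ≈τ k))))

  fixLast-transpose : ∀ (a b : Fin n) → fixLast (transpose a b) ≈ₚ transpose (ι a) (ι b)
  fixLast-transpose a b = fixLast-unique (transpose a b) (transpose (ι a) (ι b))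
    (transpose-elsewhere (ι a) (ι b) (punchInᵢ≢i last a ∘ sym) (punchInᵢ≢i last b ∘ sym))
    (transpose-natural ι ι-injective a b)

  module _ (π : Permutation′ (suc n)) (π-fixes : Fixes π) where

    remove-ι : ∀ k → π ⟨$⟩ʳ ι k ≡ ι (remove last π ⟨$⟩ʳ k)
    remove-ι k = trans (punchIn-permute π last k) (cong (λ x → punchIn x (remove last π ⟨$⟩ʳ k)) π-fixes)

    fixes-inverse : π ⟨$⟩ˡ last ≡ last
    fixes-inverse = inverse-of π π-fixes

    remove-ιˡ : ∀ k → π ⟨$⟩ˡ ι k ≡ ι (remove last π ⟨$⟩ˡ k)
    remove-ιˡ k = inverse-of π (trans (remove-ι _) (cong ι (inverseʳ (remove last π))))

  remove-∘ : ∀ (π ρ : Permutation′ (suc n)) → Fixes π → Fixes ρ →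
    remove last (π ∘ₚ ρ) ≈ₚ (remove last π ∘ₚ remove last ρ)
  remove-∘ π ρ π-fixes ρ-fixes k = ι-injective (begin
    ι (remove last (π ∘ₚ ρ) ⟨$⟩ʳ k)          ≡⟨ remove-ι (π ∘ₚ ρ) (trans (cong (ρ ⟨$⟩ʳ_) π-fixes) ρ-fixes) k ⟨
    ρ ⟨$⟩ʳ (π ⟨$⟩ʳ ι k)                      ≡⟨ cong (ρ ⟨$⟩ʳ_) (remove-ι π π-fixes k) ⟩
    ρ ⟨$⟩ʳ ι (remove last π ⟨$⟩ʳ k)          ≡⟨ remove-ι ρ ρ-fixes _ ⟩
    ι ((remove last π ∘ₚ remove last ρ) ⟨$⟩ʳ k) ∎)
    where open ≡-Reasoning

  remove-≈ : ∀ (π ρ : Permutation′ (suc n)) → Fixes π → Fixes ρ → π ≈ₚ ρ → remove last π ≈ₚ remove last ρ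
  remove-≈ π ρ π-fixes ρ-fixes π≈ρ k =
    ι-injective (trans (sym (remove-ι π π-fixes k)) (trans (π≈ρ (ι k)) (remove-ι ρ ρ-fixes k)))

  remove-injective : ∀ (π ρ : Permutation′ (suc n)) → Fixes π → Fixes ρ →
    remove last π ≈ₚ remove last ρ → π ≈ₚ ρ
  remove-injective π ρ π-fixes ρ-fixes r≈ = agree-last-ι (π ⟨$⟩ʳ_) (ρ ⟨$⟩ʳ_)
    (trans π-fixes (sym ρ-fixes))
    (λ k → trans (remove-ι π π-fixes k) (trans (cong ι (r≈ k)) (sym (remove-ι ρ ρ-fixes k))))

-- Transitivity of the equality of G(r,n) (explicit arguments: they cannot be inferred, as _≈G_ unfolds).
≈G-trans : ∀ {r n} (x y z : GEl r n) → x ≈G y → y ≈G z → x ≈G z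
≈G-trans _ _ _ (c≡ , π≡) (c≡' , π≡') = (λ j → trans (c≡ j) (c≡' j)) , (λ j → trans (π≡ j) (π≡' j))

≈⇒≈ˡ : ∀ {n} {π ρ : Permutation′ n} → π ≈ₚ ρ → ∀ j → π ⟨$⟩ˡ j ≡ ρ ⟨$⟩ˡ j
≈⇒≈ˡ {π = π} {ρ} π≈ρ j = sym (inverse-of ρ (trans (sym (π≈ρ _)) (inverseʳ π)))

·G-cong : ∀ {r n} .{{_ : NonZero r}} {x x' y y' : GEl r n} → x ≈G x' → y ≈G y' → (x ·G y) ≈G (x' ·G y')
·G-cong {x = ⟪ c , π ⟫} {⟪ c' , π' ⟫} {⟪ d , ρ ⟫} (c≡ , π≈) (d≡ , ρ≈) =
  (λ j → cong₂ (_+r_ _) (c≡ j) (trans (cong d (≈⇒≈ˡ {π = π} {π'} π≈ j)) (d≡ _))) ,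
  (λ j → trans (cong (π ⟨$⟩ʳ_) (ρ≈ j)) (π≈ _))

module Wreath (r : ℕ) .{{_ : NonZero r}} {n : ℕ} where

  open IntegersModulo r
  open AbelianGroup ℤ/r using (monoid; identityˡ; identityʳ; assoc)
  open UnitVectors monoid

  permEl : Permutation′ n → GEl r n
  permEl π = ⟪ (λ _ → 0r r) , π ⟫

  diag : (Fin n → Fin r) → GEl r n
  diag e = ⟪ e , id ⟫

  diag-·-permEl : ∀ e π → (diag e ·G permEl π) ≈G ⟪ e , π ⟫
  diag-·-permEl e π = (λ j → identityʳ (e j)) , (λ _ → refl)

  conjugate : ∀ ρ e e' → (∀ j → e (ρ ⟨$⟩ˡ j) ≡ e' j) → (permEl ρ ·G (diag e ·G permEl (flip ρ))) ≈G diag e'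
  conjugate ρ e e' e∘ρ⁻¹≗e' =
    (λ j → trans (identityˡ _) (trans (identityʳ _) (e∘ρ⁻¹≗e' j))) , (λ j → inverseʳ ρ)

  -- G(r,n) is generated by the permutations together with a single diagonal unit vector:
  -- conjugation moves the unit vector to any position, products of those give all diagonals.
  generated-by-perms-and-unit : (R : GEl r n → Set) →
    (∀ {x y} → x ≈G y → R x → R y) → (∀ {x y} → R x → R y → R (x ·G y)) →
    (∀ π → R (permEl π)) → ∀ k → R (diag (unit k ⟦ 1 ⟧)) → ∀ z → R z
  generated-by-perms-and-unit R R-resp R-mul perms k unit-k ⟪ d , π ⟫ =
    R-resp (diag-·-permEl d π) (R-mul (all-diag d) (perms π))
    where
    every-unit : ∀ k' → R (diag (unit k' ⟦ 1 ⟧))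
    every-unit k' = R-resp (conjugate ρ (unit k ⟦ 1 ⟧) (unit k' ⟦ 1 ⟧)
        (λ j → trans (unit-permute ρ k ⟦ 1 ⟧ j) (cong (λ x → unit x ⟦ 1 ⟧ j) (transpose-at-i k k'))))
      (R-mul (perms ρ) (R-mul unit-k (perms (flip ρ))))
      where
      ρ : Permutation′ n
      ρ = transpose k k'
    add-step : ∀ k' m d j → unit k' ⟦ suc m ⟧ j +ᵣ d j ≡ unit k' ⟦ 1 ⟧ j +ᵣ (unit k' ⟦ m ⟧ j +ᵣ d j)
    add-step k' m d j = begin
      unit k' ⟦ 1 + m ⟧ j +ᵣ d j                    ≡⟨ cong (λ a → unit k' a j +ᵣ d j) (⟦⟧-homo-+ 1 m) ⟩
      unit k' (⟦ 1 ⟧ +ᵣ ⟦ m ⟧) j +ᵣ d j              ≡⟨ cong (_+ᵣ d j) (unit-homo k' j ⟦ 1 ⟧ ⟦ m ⟧) ⟩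
      (unit k' ⟦ 1 ⟧ j +ᵣ unit k' ⟦ m ⟧ j) +ᵣ d j    ≡⟨ assoc _ _ _ ⟩
      unit k' ⟦ 1 ⟧ j +ᵣ (unit k' ⟦ m ⟧ j +ᵣ d j)    ∎
      where open ≡-Reasoning
    add-unit : ∀ k' m d → R (diag d) → R (diag (λ j → unit k' ⟦ m ⟧ j +ᵣ d j))
    add-unit k' zero    d Rd =
      R-resp ((λ j → sym (trans (cong (_+ᵣ d j) (unit-zero k' j)) (identityˡ (d j)))) , λ _ → refl) Rd
    add-unit k' (suc m) d Rd =
      R-resp ((λ j → sym (add-step k' m d j)) , λ _ → refl) (R-mul (every-unit k') (add-unit k' m d Rd))
    all-diag : ∀ d → R (diag d)
    all-diag = vector-induction n (λ d → R (diag d)) (λ d≈ → R-resp (d≈ , λ _ → refl)) (perms id)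
      (λ k' a d Rd → subst (λ b → R (diag (λ j → unit k' b j +ᵣ d j))) (⟦toℕ⟧ a) (add-unit k' (toℕ a) d Rd))

module Section (r : ℕ) .{{_ : NonZero r}} {n : ℕ} (φ : Fin r → Fin r)
               (φ-homo : ∀ a b → φ (_+r_ r a b) ≡ _+r_ r (φ a) (φ b)) where

  open IntegersModulo r
  open AbelianGroup ℤ/r
    using (group; commutativeMonoid; identityʳ; assoc)
    renaming (ε to 0#; _⁻¹ to -_; inverseʳ to +-inverseʳ)
  open import Algebra.Properties.Group group using (inverseʳ-unique)
  open import Algebra.Properties.CommutativeMonoid.Sum commutativeMonoid
    using (sum; ∑-distrib-+; sum-permute; sum-cong-≗; sum-replicate-zero)
  open Wreath r
  open ≡-Reasoning

  φ-0 : φ 0# ≡ 0#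
  φ-0 = begin
    φ 0#                        ≡⟨ identityʳ (φ 0#) ⟨
    φ 0# +ᵣ 0#                  ≡⟨ cong (φ 0# +ᵣ_) (+-inverseʳ (φ 0#)) ⟨
    φ 0# +ᵣ (φ 0# +ᵣ - φ 0#)    ≡⟨ assoc (φ 0#) (φ 0#) (- φ 0#) ⟨
    (φ 0# +ᵣ φ 0#) +ᵣ - φ 0#    ≡⟨ cong (_+ᵣ - φ 0#) (φ-homo 0# 0#) ⟨
    φ (0# +ᵣ 0#) +ᵣ - φ 0#      ≡⟨ cong (λ a → φ a +ᵣ - φ 0#) (identityʳ 0#) ⟩
    φ 0# +ᵣ - φ 0#              ≡⟨ +-inverseʳ (φ 0#) ⟩
    0#                          ∎

  φ-neg : ∀ a → φ (- a) ≡ - φ a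
  φ-neg a = inverseʳ-unique (φ a) (φ (- a)) (trans (sym (φ-homo a (- a))) (trans (cong φ (+-inverseʳ a)) φ-0))

  Σι : (Fin (suc n) → Fin r) → Fin r
  Σι c = sum (λ k → c (ι k))

  Σι-+ : ∀ c c' → Σι (λ j → c j +ᵣ c' j) ≡ Σι c +ᵣ Σι c'
  Σι-+ c c' = ∑-distrib-+ (λ k → c (ι k)) (λ k → c' (ι k))

  Σι-neg : ∀ c → Σι (λ j → - c j) ≡ - Σι c
  Σι-neg c = inverseʳ-unique (Σι c) (Σι (λ j → - c j)) (begin
    Σι c +ᵣ Σι (λ j → - c j)   ≡⟨ Σι-+ c (λ j → - c j) ⟨
    Σι (λ j → c j +ᵣ - c j)    ≡⟨ sum-cong-≗ (λ k → +-inverseʳ (c (ι k))) ⟩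
    sum {n} (λ _ → 0#)         ≡⟨ sum-replicate-zero n ⟩
    0#                         ∎)

  Σι-permute : ∀ π → Fixes π → ∀ c → Σι (λ j → c (π ⟨$⟩ʳ j)) ≡ Σι c
  Σι-permute π π-fixes c = begin
    Σι (λ j → c (π ⟨$⟩ʳ j))                      ≡⟨ sum-cong-≗ (λ k → cong c (remove-ι π π-fixes k)) ⟩
    sum (λ k → c (ι (remove last π ⟨$⟩ʳ k)))     ≡⟨ sum-permute (λ k → c (ι k)) (remove last π) ⟨
    Σι c                                         ∎

  InSection : GEl r (suc n) → Set
  InSection x = Fixes (perm x) × (coef x last ≡ φ (Σι (coef x)))

  section-ε : InSection εG
  section-ε = refl , sym (trans (cong φ (sum-replicate-zero n)) φ-0)

  section-· : ∀ {x y} → InSection x → InSection y → InSection (x ·G y)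
  section-· {⟪ c , π ⟫} {⟪ c' , π' ⟫} (π-fixes , c-last) (π'-fixes , c'-last) =
    trans (cong (π ⟨$⟩ʳ_) π'-fixes) π-fixes , (begin
      c last +ᵣ c' (π ⟨$⟩ˡ last)              ≡⟨ cong (λ j → c last +ᵣ c' j) (fixes-inverse π π-fixes) ⟩
      c last +ᵣ c' last                       ≡⟨ cong₂ _+ᵣ_ c-last c'-last ⟩
      φ (Σι c) +ᵣ φ (Σι c')                   ≡⟨ φ-homo (Σι c) (Σι c') ⟨
      φ (Σι c +ᵣ Σι c')                       ≡⟨ cong (λ σ → φ (Σι c +ᵣ σ)) (Σι-permute (flip π) (fixes-inverse π π-fixes) c') ⟨
      φ (Σι c +ᵣ Σι (λ j → c' (π ⟨$⟩ˡ j)))    ≡⟨ cong φ (Σι-+ c (λ j → c' (π ⟨$⟩ˡ j))) ⟨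
      φ (Σι (λ j → c j +ᵣ c' (π ⟨$⟩ˡ j)))     ∎)

  section-⁻¹ : ∀ {x} → InSection x → InSection (invG x)
  section-⁻¹ {⟪ c , π ⟫} (π-fixes , c-last) = fixes-inverse π π-fixes , (begin
    - c (π ⟨$⟩ʳ last)                  ≡⟨ cong (λ j → - c j) π-fixes ⟩
    - c last                           ≡⟨ cong -_ c-last ⟩
    - φ (Σι c)                         ≡⟨ φ-neg (Σι c) ⟨
    φ (- Σι c)                         ≡⟨ cong (λ σ → φ (- σ)) (Σι-permute π π-fixes c) ⟨
    φ (- Σι (λ j → c (π ⟨$⟩ʳ j)))      ≡⟨ cong φ (Σι-neg (λ j → c (π ⟨$⟩ʳ j))) ⟨
    φ (Σι (λ j → - c (π ⟨$⟩ʳ j)))      ∎)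

  section-≈ : ∀ {x y} → x ≈G y → InSection x → InSection y
  section-≈ {⟪ c , π ⟫} {⟪ c' , π' ⟫} (c≡ , π≈) (π-fixes , c-last) =
    trans (sym (π≈ last)) π-fixes ,
    trans (sym (c≡ last)) (trans c-last (cong φ (sum-cong-≗ (λ k → c≡ (ι k)))))

  generated-in-section : ∀ {I} {g : I → GEl r (suc n)} → (∀ i → InSection (g i)) →
    ∀ {x} → InGen g x → InSection x
  generated-in-section g-in (gen i)               = g-in i
  generated-in-section g-in one                   = section-ε
  generated-in-section g-in (mul {x} {y} x∈ y∈)   =
    section-· {x} {y} (generated-in-section g-in x∈) (generated-in-section g-in y∈)
  generated-in-section g-in (inv {x} x∈)          = section-⁻¹ {x} (generated-in-section g-in x∈)
  generated-in-section g-in (resp {x} {y} x≈y x∈) = section-≈ {x} {y} x≈y (generated-in-section g-in x∈)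

  restrict : GEl r (suc n) → GEl r n
  restrict ⟪ c , π ⟫ = ⟪ (λ k → c (ι k)) , remove last π ⟫

  restrict-≈ : ∀ {x y} → InSection x → InSection y → x ≈G y → restrict x ≈G restrict y
  restrict-≈ {⟪ c , π ⟫} {⟪ c' , π' ⟫} (π-fixes , _) (π'-fixes , _) (c≡ , π≈) =
    (λ k → c≡ (ι k)) , remove-≈ π π' π-fixes π'-fixes π≈

  restrict-· : ∀ {x y} → InSection x → InSection y → restrict (x ·G y) ≈G (restrict x ·G restrict y)
  restrict-· {⟪ c , π ⟫} {⟪ c' , π' ⟫} (π-fixes , _) (π'-fixes , _) =
    (λ k → cong (λ j → c (ι k) +ᵣ c' j) (remove-ιˡ π π-fixes k)) , remove-∘ π' π π'-fixes π-fixes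

  restrict-injective : ∀ {x y} → InSection x → InSection y → restrict x ≈G restrict y → x ≈G y
  restrict-injective {⟪ c , π ⟫} {⟪ c' , π' ⟫} (π-fixes , c-last) (π'-fixes , c'-last) (c≡ , π≈) =
    agree-last-ι c c' (trans c-last (trans (cong φ (sum-cong-≗ c≡)) (sym c'-last))) c≡ ,
    remove-injective π π' π-fixes π'-fixes π≈

  restrict-fixLast : ∀ σ → restrict (permEl (fixLast σ)) ≈G permEl σ
  restrict-fixLast σ = (λ _ → refl) , remove-insert last last σ

  open UnitVectors (AbelianGroup.monoid ℤ/r) using (unit)

  iso-criterion : ∀ {I} (g : I → GEl r (suc n)) → (∀ i → InSection (g i)) →
    (∀ σ → InGen g (permEl (fixLast σ))) →
    ∀ k {h} → InGen g h → restrict h ≈G diag (unit k ⟦ 1 ⟧) → IsoGenG g n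
  iso-criterion g g-in perms k {h} h∈ h-unit = f , f-≈ , f-· , f-injective , f-surjective
    where
    H : Set
    H = Σ (GEl r (suc n)) (InGen g)
    _·H_ : H → H → H
    x ·H y = proj₁ x ·G proj₁ y , mul (proj₂ x) (proj₂ y)
    H-in-section : (x : H) → InSection (proj₁ x)
    H-in-section (x , x∈) = generated-in-section g-in x∈
    f : H → GEl r n
    f x = restrict (proj₁ x)
    f-≈ : ∀ x y → proj₁ x ≈G proj₁ y → f x ≈G f y
    f-≈ x y = restrict-≈ {proj₁ x} {proj₁ y} (H-in-section x) (H-in-section y)
    f-· : ∀ x y → f (x ·H y) ≈G (f x ·G f y)
    f-· x y = restrict-· {proj₁ x} {proj₁ y} (H-in-section x) (H-in-section y)
    f-injective : ∀ x y → f x ≈G f y → proj₁ x ≈G proj₁ y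
    f-injective x y = restrict-injective {proj₁ x} {proj₁ y} (H-in-section x) (H-in-section y)
    Image : GEl r n → Set
    Image z = Σ H λ x → f x ≈G z
    image-≈ : ∀ {z z'} → z ≈G z' → Image z → Image z'
    image-≈ {z} {z'} z≈z' (x , fx≈z) = x , ≈G-trans (f x) z z' fx≈z z≈z'
    image-· : ∀ {z z'} → Image z → Image z' → Image (z ·G z')
    image-· {z} {z'} (x , fx≈z) (y , fy≈z') = x ·H y ,
      ≈G-trans (f (x ·H y)) (f x ·G f y) (z ·G z') (f-· x y) (·G-cong {x = f x} {z} {f y} {z'} fx≈z fy≈z')
    f-surjective : ∀ z → Image z
    f-surjective = generated-by-perms-and-unit Image
      (λ {z} {z'} → image-≈ {z} {z'}) (λ {z} {z'} → image-· {z} {z'})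
      (λ σ → (permEl (fixLast σ) , perms σ) , restrict-fixLast σ) k ((h , h∈) , h-unit)

module Generators (m r p α : ℕ) .{{_ : NonZero r}} where

  open IntegersModulo r
  open AbelianGroup ℤ/r using (monoid; commutativeMonoid; identityˡ)
  open import Algebra.Properties.CommutativeMonoid.Mult commutativeMonoid using (×-distrib-+) renaming (_×_ to _×ᵣ_)
  open import Algebra.Properties.CommutativeMonoid.Sum commutativeMonoid using (sum-cong-≗)
  open UnitVectors monoid using (unit; unit-sum)
  open Wreath r

  -- c̄ ends with αp − 1; multiplication by it is the map φ of the section containing the u_i
  w : ℕ
  w = α * p + (r ∸ 1)

  open Section r {suc m} (w ×ᵣ_) (λ a b → ×-distrib-+ a b w)

  g : Fin (suc m) → GEl r (suc (suc m))
  g = u m r p α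

  c̄ : Fin (suc (suc m)) → Fin r
  c̄ = cbar m r p α

  c̄-last : c̄ last ≡ ⟦ w ⟧
  c̄-last rewrite toℕ-fromℕ m | dec-true (m ℕ.≟ m) refl = refl

  c̄-ι : ∀ k → c̄ (ι k) ≡ unit zero ⟦ 1 ⟧ k
  c̄-ι zero    = refl
  c̄-ι (suc k) rewrite dec-false (toℕ (ι k) ℕ.≟ m) (<⇒≢ (toℕ-ι<n k)) = refl

  Σι-c̄ : Σι c̄ ≡ ⟦ 1 ⟧
  Σι-c̄ = trans (sum-cong-≗ c̄-ι) (unit-sum {suc m} zero ⟦ 1 ⟧)

  -- t_i fixes the last position, since it only involves s_1, …, s_i with i ≤ n − 2
  t-fixes : ∀ j h → Fixes (t m j h)
  t-fixes zero    h = refl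
  t-fixes (suc j) h = trans (cong (s m x ⟨$⟩ʳ_) (t-fixes j h'))
                            (transpose-elsewhere (inject₁ x) (suc x) fromℕ≢inject₁ last≢suc-x)
    where
    h' : j < suc m
    h' = <-trans (n<1+n j) h
    x : Fin (suc m)
    x = fromℕ< h'
    last≢suc-x : last ≢ suc x
    last≢suc-x last≡suc-x = <⇒≢ h (cong suc (trans (sym (toℕ-fromℕ< h'))
                              (trans (cong toℕ (suc-injective (sym last≡suc-x))) (toℕ-fromℕ m))))

  u-in-section : ∀ i → InSection (g i)
  u-in-section i = t-fixes (toℕ i) (toℕ<n i) , (begin
    c̄ last        ≡⟨ c̄-last ⟩
    ⟦ w ⟧         ≡⟨ ⟦⟧-multiple w ⟩
    w ×ᵣ ⟦ 1 ⟧    ≡⟨ cong (w ×ᵣ_) Σι-c̄ ⟨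
    w ×ᵣ Σι c̄     ∎)
    where open ≡-Reasoning

  u₀-restrict : restrict (g zero) ≈G diag (unit zero ⟦ 1 ⟧)
  u₀-restrict = c̄-ι , (λ k → sym (ι-injective (remove-ι id refl k)))

  -- u₀⁻¹ u_i = t_i
  t-in-H : ∀ i → InGen g (permEl (t m (toℕ i) (toℕ<n i)))
  t-in-H i = resp {x = invG (g zero) ·G g i} ((λ j → -r-inverseˡ (c̄ j)) , (λ _ → refl))
    (mul (inv (gen zero)) (gen i))

  t-irrelevant : ∀ j h h' → t m j h ≈ₚ t m j h'
  t-irrelevant zero    h h' k = refl
  t-irrelevant (suc j) h h' k = cong (s m (fromℕ< (<-trans (n<1+n j) h)) ⟨$⟩ʳ_) (t-irrelevant j _ _ k)

  t-cong : ∀ {j j'} → j ≡ j' → ∀ h h' → t m j h ≈ₚ t m j' h'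
  t-cong {j} refl = t-irrelevant j

  -- t_{i+1} t_i⁻¹ = s_{i+1}, which is fixLast of an adjacent transposition of S_{n-1}
  adjacent-in-H : ∀ (i : Fin m) → InGen g (permEl (fixLast (adjacent i)))
  adjacent-in-H i = resp {x = permEl A ·G invG (permEl B)} ((λ _ → -r-inverseʳ (0r r)) , A∘B⁻¹≈s)
    (mul (t-in-H (suc i)) (inv (t-in-H (inject₁ i))))
    where
    h' : toℕ i < suc m
    h' = <-trans (n<1+n (toℕ i)) (toℕ<n (suc i))
    A B : Permutation′ (suc (suc m))
    A = t m (toℕ (suc i)) (toℕ<n (suc i))
    B = t m (toℕ (inject₁ i)) (toℕ<n (inject₁ i))
    x≡inject₁i : fromℕ< h' ≡ inject₁ i
    x≡inject₁i = toℕ-injective (trans (toℕ-fromℕ< h') (sym (toℕ-inject₁ i)))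
    t-i-B⁻¹ : ∀ j → t m (toℕ i) h' ⟨$⟩ʳ (B ⟨$⟩ˡ j) ≡ j
    t-i-B⁻¹ j = trans (t-cong (sym (toℕ-inject₁ i)) h' _ (B ⟨$⟩ˡ j)) (inverseʳ B)
    A∘B⁻¹≈s : ∀ j → A ⟨$⟩ʳ (B ⟨$⟩ˡ j) ≡ fixLast (adjacent i) ⟨$⟩ʳ j
    A∘B⁻¹≈s j = begin
      s m (fromℕ< h') ⟨$⟩ʳ (t m (toℕ i) h' ⟨$⟩ʳ (B ⟨$⟩ˡ j))      ≡⟨ cong (s m (fromℕ< h') ⟨$⟩ʳ_) (t-i-B⁻¹ j) ⟩
      s m (fromℕ< h') ⟨$⟩ʳ j                                    ≡⟨ cong (λ y → s m y ⟨$⟩ʳ j) x≡inject₁i ⟩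
      transpose (inject₁ (inject₁ i)) (suc (inject₁ i)) ⟨$⟩ʳ j  ≡⟨ cong₂ (λ a b → transpose a b ⟨$⟩ʳ j)
                                                                    (ι≡inject₁ (inject₁ i)) (ι≡inject₁ (suc i)) ⟨
      transpose (ι (inject₁ i)) (ι (suc i)) ⟨$⟩ʳ j              ≡⟨ fixLast-transpose (inject₁ i) (suc i) j ⟨
      fixLast (adjacent i) ⟨$⟩ʳ j                               ∎
      where open ≡-Reasoning

  fixLast-in-H : ∀ σ → InGen g (permEl (fixLast σ))
  fixLast-in-H = adjacent-generate m (λ σ → InGen g (permEl (fixLast σ))) submonoid adjacent-in-H
    where
    submonoid : IsSubmonoid (λ σ → InGen g (permEl (fixLast σ)))
    submonoid = record
      { respects = λ σ≈τ → resp ((λ _ → refl) , fixLast-cong σ≈τ)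
      ; has-id   = resp {x = εG} ((λ _ → refl) , (λ j → sym (fixLast-id j))) one
      ; closed-∘ = λ {σ} {τ} σ∈ τ∈ → resp {x = permEl (fixLast τ) ·G permEl (fixLast σ)}
                     ((λ _ → identityˡ (0r r)) , (λ j → sym (fixLast-∘ σ τ j))) (mul τ∈ σ∈)
      }

  isomorphism : IsoGenG g (suc m)
  isomorphism = iso-criterion g u-in-section fixLast-in-H zero (gen zero) u₀-restrict

lemma3p4 : (m r p α : ℕ) → .{{_ : NonZero r}} → (pr : NonZero p) → p ∣ r →
    α < _/_ r p {{pr}} → IsoGenG (u m r p α) (suc m)
lemma3p4 m r p α _ _ _ = Generators.isomorphism m r p α
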